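{- Let $\Gamma$ be a finite $(G,2)$-geodesic-transitive digraph of valency $4$, where $G\leq\mathrm{Aut}(\Gamma)$. Then $\Gamma$ is $(G,2)$-arc-transitive.
   Context: A digraph $\Gamma$ consists of a finite vertex set $V(\Gamma)$ with an antisymmetric irreflexive relation $\rightarrow$; an arc is an ordered pair $(u,v)$ with $u\rightarrow v$; $\Gamma^+(v)=\{w: v\rightarrow w\}$ and the valency is $|\Gamma^+(v)|$. The distance $d_\Gamma(u,v)$ is the length of a shortest directed path from $u$ to $v$. An $s$-arc is a sequence $(v_0,\dots,v_s)$ with $v_i\rightarrow v_{i+1}$ for all $i$; it is an $s$-geodesic if $d_\Gamma(v_0,v_s)=s$. $\Gamma$ is $(G,s)$-geodesic-transitive if $G$ is transitive on the set of $i$-geodesics for each $i\leq s$, and $(G,2)$-arc-transitive if $G$ is transitive on the set of $2$-arcs. -}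

module Defs where

open import Level using (0ℓ)
open import Data.Nat using (ℕ; zero; suc; _<_; _≤_)
open import Data.Fin using (Fin)
open import Data.List using (List; filter; length; allFin)
open import Data.Vec as Vec using (Vec; []; _∷_; head; last)
open import Data.Product using (Σ; _×_; _,_; ∃)
open import Data.Unit using (⊤)
open import Data.Empty using (⊥)
open import Relation.Nullary using (¬_)
open import Relation.Unary using (Pred; _∈_)
open import Relation.Binary using (Decidable)
open import Relation.Binary.PropositionalEquality using (_≡_)
open import Function.Bundles using (Inverse; _↔_)
import Function.Construct.Identity as Id
import Function.Construct.Composition as Comp
import Function.Construct.Symmetry as Sym

record Digraph (n : ℕ) : Set₁ where
  field
    _⟶_      : Fin n → Fin n → Set
    _⟶?_     : Decidable _⟶_
    irrefl   : ∀ v → ¬ (v ⟶ v)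
    antisym  : ∀ u v → u ⟶ v → ¬ (v ⟶ u)

module _ {n : ℕ} (Γ : Digraph n) where
  open Digraph Γ

  outValency : Fin n → ℕ
  outValency v = length (filter (v ⟶?_) (allFin n))

  HasValency : ℕ → Set
  HasValency k = ∀ v → outValency v ≡ k

  data Walk : Fin n → Fin n → ℕ → Set where
    here : ∀ {u} → Walk u u zero
    step : ∀ {u w v k} → u ⟶ w → Walk w v k → Walk u v (suc k)

  Dist : Fin n → Fin n → ℕ → Set
  Dist u v s = Walk u v s × (∀ k → k < s → ¬ Walk u v k)

  IsArcSeq : ∀ {s} → Vec (Fin n) (suc s) → Set
  IsArcSeq (x ∷ [])     = ⊤
  IsArcSeq (x ∷ y ∷ xs) = (x ⟶ y) × IsArcSeq (y ∷ xs)

  IsGeodesic : ∀ {s} → Vec (Fin n) (suc s) → Set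
  IsGeodesic {s} xs = IsArcSeq xs × Dist (head xs) (last xs) s

  IsAut : (Fin n ↔ Fin n) → Set
  IsAut g = ∀ u v → (u ⟶ v → Inverse.to g u ⟶ Inverse.to g v)
                  × (Inverse.to g u ⟶ Inverse.to g v → u ⟶ v)

  record IsAutSubgroup (G : Pred (Fin n ↔ Fin n) 0ℓ) : Set where
    field
      aut    : ∀ g → g ∈ G → IsAut g
      has-id : Id.↔-id (Fin n) ∈ G
      closed-∘ : ∀ g h → g ∈ G → h ∈ G → Comp._↔-∘_ g h ∈ G
      closed-⁻¹ : ∀ g → g ∈ G → Sym.↔-sym g ∈ G

  TransitiveOn : (G : Pred (Fin n ↔ Fin n) 0ℓ) → ∀ {s} → Pred (Vec (Fin n) (suc s)) 0ℓ → Set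
  TransitiveOn G S = ∀ xs ys → S xs → S ys →
    Σ (Fin n ↔ Fin n) λ g → g ∈ G × Vec.map (Inverse.to g) xs ≡ ys

  GeodesicTransitive : Pred (Fin n ↔ Fin n) 0ℓ → ℕ → Set
  GeodesicTransitive G s = ∀ i → i ≤ s → TransitiveOn G (IsGeodesic {i})

  ArcTransitive : Pred (Fin n ↔ Fin n) 0ℓ → ℕ → Set
  ArcTransitive G s = TransitiveOn G (IsArcSeq {s})

-- If u ⟶ v ⟶ w with u ⟶ w, arc-transitivity makes the number of common
-- out-neighbours of the two ends of an arc a constant c ≥ 1.  If c ≥ 2, any two
-- common out-neighbours p ≠ q of u and v are joined by an arc p ⟶ q, since
-- otherwise u would have the five out-neighbours v, p, q and two common
-- out-neighbours of u and p; applied to both orders this contradicts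
-- antisymmetry, so c = 1.  Then with a the common out-neighbour of v ⟶ w and b
-- that of v ⟶ a, both (u, v, a) and (u, v, b) are 2-geodesics, and an element of
-- G taking one to the other fixes u, v, hence w, hence a, although it sends a to
-- b ≠ a.  So every 2-arc is a 2-geodesic.
module Submission where

open import Defs
open import Level using (0ℓ)
open import Data.Nat using (ℕ; zero; suc; _≤_; _<_; s≤s; z≤n)
open import Data.Nat.Properties using (≤-refl; <-irrefl)
open import Data.Fin using (Fin; _≟_)
open import Data.Fin.Properties using (injective⇒≤; any?)
open import Data.List as List using (filter; allFin)
open import Data.List.Membership.Propositional using () renaming (_∈_ to _∈ₗ_)
open import Data.List.Membership.Propositional.Properties using (∈-filter⁺; ∈-allFin)
open import Data.List.Relation.Unary.Any using (index)
open import Data.List.Relation.Unary.Any.Properties using (lookup-index)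
open import Data.Vec as Vec using (Vec; []; _∷_)
open import Data.Vec.Relation.Unary.All using (All; []; _∷_)
open import Data.Vec.Relation.Unary.AllPairs using ([]; _∷_)
open import Data.Vec.Relation.Unary.All.Properties using (lookup⁺)
open import Data.Vec.Relation.Unary.Unique.Propositional using (Unique)
open import Data.Vec.Relation.Unary.Unique.Propositional.Properties using (lookup-injective)
open import Data.Product using (Σ; ∃; _×_; _,_; proj₁)
open import Data.Sum using (_⊎_; inj₁; inj₂)
open import Data.Unit using (tt)
open import Data.Empty using (⊥; ⊥-elim)
open import Relation.Nullary using (¬_; yes; no)
open import Relation.Nullary.Decidable using (_×-dec_; ¬?; decidable-stable)
open import Relation.Unary using (Pred; _∈_)
open import Relation.Binary.PropositionalEquality
  using (_≡_; _≢_; ≢-sym; refl; sym; trans; cong; subst; subst₂)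
open import Function.Bundles using (_↔_; Inverse; Injection)
open import Function.Definitions using (Injective)
open import Function.Properties.Inverse using (↔⇒↣)

module _ {n : ℕ} (Γ : Digraph n) where
  open Digraph Γ

  ⟶⇒≢ : ∀ {x y} → x ⟶ y → x ≢ y
  ⟶⇒≢ {x} xy refl = irrefl x xy

  ⟶-⟶⇒≢ : ∀ {x y z} → x ⟶ y → y ⟶ z → x ≢ z
  ⟶-⟶⇒≢ {x} {y} xy yz refl = antisym x y xy yz

  arc⇒geodesic : ∀ {xs : Vec (Fin n) 2} → IsArcSeq Γ xs → IsGeodesic Γ xs
  arc⇒geodesic {x ∷ y ∷ []} arcs@(xy , tt) = arcs , step xy here , noShorter
    where
    noShorter : ∀ k → k < 1 → ¬ Walk Γ x y k
    noShorter zero    _             here = ⟶⇒≢ xy refl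
    noShorter (suc k) (s≤s ()) _

  2-arc-¬shortcut⇒geodesic : ∀ {x y z} → IsArcSeq Γ (x ∷ y ∷ z ∷ []) → ¬ (x ⟶ z) →
                              IsGeodesic Γ (x ∷ y ∷ z ∷ [])
  2-arc-¬shortcut⇒geodesic arcs@(xy , yz , tt) ¬xz = arcs , step xy (step yz here) , noShorter
    where
    noShorter : ∀ k → k < 2 → ¬ Walk Γ _ _ k
    noShorter zero          _                   here              = ⟶-⟶⇒≢ xy yz refl
    noShorter (suc zero)    _                   (step xz here)    = ¬xz xz
    noShorter (suc (suc k)) (s≤s (s≤s ())) _

  CommonOut : Fin n → Fin n → Fin n → Set
  CommonOut x y z = x ⟶ z × y ⟶ z

  AtMostOneCommonOut : Fin n → Fin n → Set
  AtMostOneCommonOut x y = ∀ {z₁ z₂} → CommonOut x y z₁ → CommonOut x y z₂ → z₁ ≡ z₂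

  distinctOutNeighbours⇒≤ : ∀ {v m} {xs : Vec (Fin n) m} →
                            Unique xs → All (v ⟶_) xs → m ≤ outValency Γ v
  distinctOutNeighbours⇒≤ {v} {xs = xs} unique arcs = injective⇒≤ positionInjective
    where
    outNeighbours : List.List (Fin n)
    outNeighbours = filter (v ⟶?_) (allFin n)

    inOutNeighbours : ∀ i → Vec.lookup xs i ∈ₗ outNeighbours
    inOutNeighbours i = ∈-filter⁺ (v ⟶?_) (∈-allFin _) (lookup⁺ arcs i)

    position : ∀ i → Fin (List.length outNeighbours)
    position i = index (inOutNeighbours i)

    positionInjective : Injective _≡_ _≡_ position
    positionInjective {i} {j} eq = lookup-injective unique i j
      (trans (lookup-index (inOutNeighbours i))
        (trans (cong (List.lookup outNeighbours) eq)
               (sym (lookup-index (inOutNeighbours j)))))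

module _ {n : ℕ} {Γ : Digraph n} {G : Pred (Fin n ↔ Fin n) 0ℓ} where
  open Digraph Γ

  private
    to : (Fin n ↔ Fin n) → Fin n → Fin n
    to = Inverse.to

    map-∷₃ : ∀ (f : Fin n → Fin n) {x y z x′ y′ z′} →
             Vec.map f (x ∷ y ∷ z ∷ []) ≡ x′ ∷ y′ ∷ z′ ∷ [] → f x ≡ x′ × f y ≡ y′ × f z ≡ z′
    map-∷₃ _ refl = refl , refl , refl

  geodesicArcs⇒arcTransitive : ∀ {s} →
    (∀ {xs : Vec (Fin n) (suc s)} → IsArcSeq Γ xs → IsGeodesic Γ xs) →
    TransitiveOn Γ G (IsGeodesic Γ {s}) → ArcTransitive Γ G s
  geodesicArcs⇒arcTransitive geodesic transitive xs ys xsArcs ysArcs =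
    transitive xs ys (geodesic xsArcs) (geodesic ysArcs)

  geodesicTransitive⇒arcTransitive : ∀ {s} → GeodesicTransitive Γ G (suc s) → ArcTransitive Γ G 1
  geodesicTransitive⇒arcTransitive transitive =
    geodesicArcs⇒arcTransitive (arc⇒geodesic Γ) (transitive 1 (s≤s z≤n))

  module _ (SG : IsAutSubgroup Γ G) where
    open IsAutSubgroup SG

    aut-commonOut : ∀ {g x y z} → g ∈ G →
                    CommonOut Γ x y z → CommonOut Γ (to g x) (to g y) (to g z)
    aut-commonOut {g} {x} {y} {z} g∈G (xz , yz) =
      proj₁ (aut g g∈G x z) xz , proj₁ (aut g g∈G y z) yz

    commonOut-fixed : ∀ {g x y z} → g ∈ G → AtMostOneCommonOut Γ x y → CommonOut Γ x y z →
                      to g x ≡ x → to g y ≡ y → to g z ≡ z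
    commonOut-fixed {g} {z = z} g∈G atMostOne xyz gx≡x gy≡y =
      atMostOne (subst₂ (λ x y → CommonOut Γ x y (to g z)) gx≡x gy≡y (aut-commonOut g∈G xyz)) xyz

    module _ (arcTransitive : ArcTransitive Γ G 1) where

      commonOut-transport : ∀ {x y x′ y′} → x ⟶ y → x′ ⟶ y′ →
        Σ (Fin n ↔ Fin n) λ g → g ∈ G × (∀ {z} → CommonOut Γ x y z → CommonOut Γ x′ y′ (to g z))
      commonOut-transport xy x′y′ with arcTransitive _ _ (xy , tt) (x′y′ , tt)
      ... | g , g∈G , refl = g , g∈G , aut-commonOut g∈G

      commonOut-exists : ∀ {x y z x′ y′} → x ⟶ y → CommonOut Γ x y z → x′ ⟶ y′ → ∃ (CommonOut Γ x′ y′)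
      commonOut-exists xy xyz x′y′ with commonOut-transport xy x′y′
      ... | g , _ , transport = to g _ , transport xyz

      twoCommonOuts-transport : ∀ {x y z₁ z₂ x′ y′} → x ⟶ y →
        CommonOut Γ x y z₁ → CommonOut Γ x y z₂ → z₁ ≢ z₂ → x′ ⟶ y′ →
        Σ (Fin n) λ z₁′ → Σ (Fin n) λ z₂′ → z₁′ ≢ z₂′ × CommonOut Γ x′ y′ z₁′ × CommonOut Γ x′ y′ z₂′
      twoCommonOuts-transport xy xyz₁ xyz₂ z₁≢z₂ x′y′ with commonOut-transport xy x′y′
      ... | g , _ , transport = to g _ , to g _ ,
        (λ eq → z₁≢z₂ (Injection.injective (↔⇒↣ g) eq)) , transport xyz₁ , transport xyz₂

      atMostOneCommonOut-transport : ∀ {x y x′ y′} → x ⟶ y → AtMostOneCommonOut Γ x y →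
                                     x′ ⟶ y′ → AtMostOneCommonOut Γ x′ y′
      atMostOneCommonOut-transport xy atMostOne x′y′ x′y′z₁ x′y′z₂ with commonOut-transport x′y′ xy
      ... | g , _ , transport =
        Injection.injective (↔⇒↣ g) (atMostOne (transport x′y′z₁) (transport x′y′z₂))

      commonOuts-adjacent : ∀ {u v w₁ w₂ p q} → u ⟶ v →
        CommonOut Γ u v w₁ → CommonOut Γ u v w₂ → w₁ ≢ w₂ →
        CommonOut Γ u v p → CommonOut Γ u v q → p ≢ q → p ⟶ q ⊎ 5 ≤ outValency Γ u
      commonOuts-adjacent {v = v} {p = p} {q} uv uvw₁ uvw₂ w₁≢w₂ (up , vp) (uq , vq) p≢q
        with twoCommonOuts-transport uv uvw₁ uvw₂ w₁≢w₂ up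
      ... | z₁ , z₂ , z₁≢z₂ , (uz₁ , pz₁) , (uz₂ , pz₂) with z₁ ≟ q | z₂ ≟ q
      ... | yes refl    | _           = inj₁ pz₁
      ... | no _        | yes refl    = inj₁ pz₂
      ... | no z₁≢q     | no z₂≢q     =
        inj₂ (distinctOutNeighbours⇒≤ Γ distinct (uv ∷ up ∷ uq ∷ uz₁ ∷ uz₂ ∷ []))
        where
        distinct : Unique (v ∷ p ∷ q ∷ z₁ ∷ z₂ ∷ [])
        distinct = (⟶⇒≢ Γ vp ∷ ⟶⇒≢ Γ vq ∷ ⟶-⟶⇒≢ Γ vp pz₁ ∷ ⟶-⟶⇒≢ Γ vp pz₂ ∷ [])
                 ∷ (p≢q ∷ ⟶⇒≢ Γ pz₁ ∷ ⟶⇒≢ Γ pz₂ ∷ [])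
                 ∷ (≢-sym z₁≢q ∷ ≢-sym z₂≢q ∷ [])
                 ∷ (z₁≢z₂ ∷ [])
                 ∷ [] ∷ []

      twoCommonOuts⇒5≤outValency : ∀ {u v w₁ w₂} → u ⟶ v →
        CommonOut Γ u v w₁ → CommonOut Γ u v w₂ → w₁ ≢ w₂ → 5 ≤ outValency Γ u
      twoCommonOuts⇒5≤outValency uv uvw₁ uvw₂ w₁≢w₂
        with commonOuts-adjacent uv uvw₁ uvw₂ w₁≢w₂ uvw₁ uvw₂ w₁≢w₂
           | commonOuts-adjacent uv uvw₁ uvw₂ w₁≢w₂ uvw₂ uvw₁ (≢-sym w₁≢w₂)
      ... | inj₁ w₁w₂ | inj₁ w₂w₁ = ⊥-elim (antisym _ _ w₁w₂ w₂w₁)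
      ... | inj₂ 5≤d  | _         = 5≤d
      ... | inj₁ _    | inj₂ 5≤d  = 5≤d

    module _ (transitive : GeodesicTransitive Γ G 2) where
      private
        arcTransitive : ArcTransitive Γ G 1
        arcTransitive = geodesicTransitive⇒arcTransitive transitive

      commonOut⇒¬atMostOneCommonOut : ∀ {u v w} → u ⟶ v → CommonOut Γ u v w →
                                      ¬ AtMostOneCommonOut Γ u v
      commonOut⇒¬atMostOneCommonOut {u} {v} {w} uv uvw@(uw , vw) atMostOne
        with commonOut-exists arcTransitive uv uvw vw
      ... | a , va , wa with commonOut-exists arcTransitive uv uvw va
      ... | b , vb , ab
        with transitive 2 ≤-refl (u ∷ v ∷ a ∷ []) (u ∷ v ∷ b ∷ [])
               (2-arc-¬shortcut⇒geodesic Γ (uv , va , tt)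
                  (λ ua → ⟶⇒≢ Γ wa (atMostOne uvw (ua , va))))
               (2-arc-¬shortcut⇒geodesic Γ (uv , vb , tt)
                  (λ ub → ⟶-⟶⇒≢ Γ wa ab (atMostOne uvw (ub , vb))))
      ... | g , g∈G , eq with map-∷₃ (to g) eq
      ... | gu≡u , gv≡v , ga≡b = ⟶⇒≢ Γ ab (trans (sym ga≡a) ga≡b)
        where
        gw≡w : to g w ≡ w
        gw≡w = commonOut-fixed g∈G atMostOne uvw gu≡u gv≡v

        ga≡a : to g a ≡ a
        ga≡a = commonOut-fixed g∈G (atMostOneCommonOut-transport arcTransitive uv atMostOne vw)
                               (va , wa) gv≡v gw≡w

module _ {n : ℕ} {Γ : Digraph n} {G : Pred (Fin n ↔ Fin n) 0ℓ} (SG : IsAutSubgroup Γ G)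
         (valency : HasValency Γ 4) (transitive : GeodesicTransitive Γ G 2) where
  open Digraph Γ

  noTransitiveTriangle : ∀ {u v w} → u ⟶ v → v ⟶ w → ¬ (u ⟶ w)
  noTransitiveTriangle {u} {v} {w} uv vw uw
    with any? (λ z → ((u ⟶? z) ×-dec (v ⟶? z)) ×-dec ¬? (z ≟ w))
  ... | yes (w′ , uvw′ , w′≢w) =
    <-irrefl refl (subst (5 ≤_) (valency u)
      (twoCommonOuts⇒5≤outValency SG (geodesicTransitive⇒arcTransitive transitive)
                                  uv uvw′ (uw , vw) w′≢w))
  ... | no noOther = commonOut⇒¬atMostOneCommonOut SG transitive uv (uw , vw) atMostOne
    where
    onlyW : ∀ {z} → CommonOut Γ u v z → z ≡ w
    onlyW {z} uvz = decidable-stable (z ≟ w) (λ z≢w → noOther (z , uvz , z≢w))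

    atMostOne : AtMostOneCommonOut Γ u v
    atMostOne uvz₁ uvz₂ = trans (onlyW uvz₁) (sym (onlyW uvz₂))

  2-arc⇒geodesic : ∀ {xs : Vec (Fin n) 3} → IsArcSeq Γ xs → IsGeodesic Γ xs
  2-arc⇒geodesic {_ ∷ _ ∷ _ ∷ []} arcs@(uv , vw , tt) =
    2-arc-¬shortcut⇒geodesic Γ arcs (noTransitiveTriangle uv vw)

lemma4p7 : ∀ {n : ℕ} (Γ : Digraph n) (G : Pred (Fin n ↔ Fin n) 0ℓ) →
    IsAutSubgroup Γ G → HasValency Γ 4 → GeodesicTransitive Γ G 2 →
    ArcTransitive Γ G 2
lemma4p7 Γ G SG valency transitive =
  geodesicArcs⇒arcTransitive (2-arc⇒geodesic SG valency transitive) (transitive 2 ≤-refl)
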